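{- Let $P$ be a binary matrix with $n$ columns whose rows are $\mathbf{p}\in\mathbb{F}_2^n$. For $\mathbf{d}\in\mathbb{F}_2^n$ let $P_{\mathbf{d}}$ denote the set (submatrix) of rows $\mathbf{p}$ of $P$ with $\mathbf{p}\cdot\mathbf{d}^T=1$. Define the random variable $\mathbf{Y}$ on $\mathbb{F}_2^n$ by $\Pr(\mathbf{Y}=\mathbf{y})=\Pr_{\mathbf{d},\mathbf{e}}\bigl(\sum_{\mathbf{p}\in P_{\mathbf{d}}\cap P_{\mathbf{e}}}\mathbf{p}=\mathbf{y}\bigr)$ with $\mathbf{d},\mathbf{e}$ independent and uniform on $\mathbb{F}_2^n$. For $\mathbf{s}\in\mathbb{F}_2^n$ let $\mathcal{C}_{\mathbf{s}}$ be the code spanned by the columns of $P_{\mathbf{s}}$. Then \[ \Pr(\mathbf{Y}\cdot\mathbf{s}^T=0)=\Pr\bigl(\mathbf{c}_1^T\mathbf{c}_2=0\mid \mathbf{c}_1,\mathbf{c}_2\sim\mathcal{C}_{\mathbf{s}}\bigr)=\tfrac12\Bigl(1+2^{ -\mathrm{rank}(P_{\mathbf{s}}^TP_{\mathbf{s}})}\Bigr), \] where $\mathbf{c}_1,\mathbf{c}_2$ are independent uniform codewords; hence this bias is a matroid invariant of $P_{\mathbf{s}}$.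
   Context: All arithmetic is over $\mathbb{F}_2$; the rank of $P_{\mathbf{s}}^TP_{\mathbf{s}}$ (an $n\times n$ matrix) is over $\mathbb{F}_2$. The matroid of a binary matrix is its class under row permutations and invertible column operations. -}

module Defs where

open import Data.Bool using (Bool; true; false; _∧_; _∨_; _xor_; not; if_then_else_)
open import Data.Nat using (ℕ; zero; suc; _+_; _⊔_)
open import Data.List using (List; []; _∷_; _++_; map; foldr; length; concatMap)
open import Data.Vec using (Vec; []; _∷_; replicate; zipWith; lookup; tabulate; toList)
open import Data.Fin using (Fin)
open import Data.Product using (_×_; _,_)

-- Vectors in F₂ⁿ are Vec Bool n (true = 1); addition is xor, product is ∧.

dot : ∀ {n} → Vec Bool n → Vec Bool n → Bool
dot [] [] = false
dot (a ∷ u) (b ∷ v) = (a ∧ b) xor dot u v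

vzero : (n : ℕ) → Vec Bool n
vzero n = replicate n false

_⊕_ : ∀ {n} → Vec Bool n → Vec Bool n → Vec Bool n
_⊕_ = zipWith _xor_

vsum : ∀ {n} → List (Vec Bool n) → Vec Bool n
vsum {n} = foldr _⊕_ (vzero n)

isZero : ∀ {n} → Vec Bool n → Bool
isZero [] = true
isZero (a ∷ v) = not a ∧ isZero v

eqv : ∀ {n} → Vec Bool n → Vec Bool n → Bool
eqv u v = isZero (u ⊕ v)

allVecs : (n : ℕ) → List (Vec Bool n)
allVecs zero = [] ∷ []
allVecs (suc n) = map (false ∷_) (allVecs n) ++ map (true ∷_) (allVecs n)

allPairs : (n : ℕ) → List (Vec Bool n × Vec Bool n)
allPairs n = concatMap (λ d → map (λ e → d , e) (allVecs n)) (allVecs n)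

count : {A : Set} → (A → Bool) → List A → ℕ
count p [] = 0
count p (x ∷ xs) = (if p x then 1 else 0) + count p xs

anyB : {A : Set} → (A → Bool) → List A → Bool
anyB p [] = false
anyB p (x ∷ xs) = p x ∨ anyB p xs

allB : {A : Set} → (A → Bool) → List A → Bool
allB p [] = true
allB p (x ∷ xs) = p x ∧ allB p xs

filterB : {A : Set} → (A → Bool) → List A → List A
filterB p [] = []
filterB p (x ∷ xs) = if p x then x ∷ filterB p xs else filterB p xs

maxL : List ℕ → ℕ
maxL = foldr _⊔_ 0

-- Binary matrices with n columns, given as the list of their rows.

Mat : ℕ → Set
Mat n = List (Vec Bool n)

sub : ∀ {n} → Mat n → Vec Bool n → Mat n
sub P d = filterB (λ p → dot p d) P

mulVec : ∀ {n} (M : Mat n) → Vec Bool n → Vec Bool (length M)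
mulVec [] x = []
mulVec (p ∷ M) x = dot p x ∷ mulVec M x

Yval : ∀ {n} → Mat n → Vec Bool n → Vec Bool n → Vec Bool n
Yval P d e = vsum (filterB (λ p → dot p d ∧ dot p e) P)

-- number of pairs (d,e) ∈ F₂ⁿ × F₂ⁿ with Y(d,e) · sᵀ = 0
-- (so Pr(Y · sᵀ = 0) = countY P s / 4ⁿ)
countY : ∀ {n} → Mat n → Vec Bool n → ℕ
countY {n} P s = count (λ de → not (dot (Yval P (Data.Product.proj₁ de) (Data.Product.proj₂ de)) s)) (allPairs n)

inCode : ∀ {n} (M : Mat n) → Vec Bool (length M) → Bool
inCode {n} M c = anyB (λ x → eqv (mulVec M x) c) (allVecs n)

codeSize : ∀ {n} → Mat n → ℕ
codeSize M = count (inCode M) (allVecs (length M))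

-- number of pairs (c₁,c₂) ∈ C × C with c₁ᵀ c₂ = 0
-- (so Pr(c₁ᵀc₂ = 0 | c₁,c₂ ~ C) = countOrth M / |C|²)
countOrth : ∀ {n} → Mat n → ℕ
countOrth M = count (λ cc → inCode M (Data.Product.proj₁ cc) ∧ inCode M (Data.Product.proj₂ cc)
                           ∧ not (dot (Data.Product.proj₁ cc) (Data.Product.proj₂ cc)))
                    (allPairs (length M))

-- Mᵀ M (n × n), as list of rows; row i = Σ_{p ∈ M} p_i p
gram : ∀ {n} → Mat n → Mat n
gram {n} M = toList (tabulate (λ (i : Fin n) →
  vsum (map (λ p → if lookup p i then p else vzero n) M)))

-- subsets of columns as indicator vectors
subsetOf : ∀ {n} → Vec Bool n → Vec Bool n → Bool
subsetOf [] [] = true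
subsetOf (a ∷ u) (b ∷ v) = (not a ∨ b) ∧ subsetOf u v

weight : ∀ {n} → Vec Bool n → ℕ
weight [] = 0
weight (a ∷ v) = (if a then 1 else 0) + weight v

colsIndep : ∀ {n} → Mat n → Vec Bool n → Bool
colsIndep {n} M S =
  allB (λ x → not (subsetOf x S) ∨ isZero x ∨ not (isZero (mulVec M x))) (allVecs n)

rank : ∀ {n} → Mat n → ℕ
rank {n} M = maxL (map (λ S → if colsIndep M S then weight S else 0) (allVecs n))

module Submission where

-- Write Q = P_s, N = 2ⁿ, K = |ker Q|, C = |C_s| = |im Q|, O the number of
-- orthogonal pairs in C_s², and K_G = |ker QᵀQ|.  All counts are turned into
-- sums over cubes F₂ᵏ, and the proof rests on three general facts about a
-- linear map f on F₂ⁿ: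
--   * summing g ∘ f over F₂ⁿ equals |ker f| times summing g over im f;
--     in particular |ker f| · |im f| = 2ⁿ;
--   * 2^(rank f) · |ker f| = 2ⁿ, using a basis made of unit vectors;
--   * d · v = 0 for exactly half of all d ∈ F₂ⁿ, unless v = 0.
-- Since the rows p with p · s = 0 do not contribute, Y(d,e) · sᵀ = (Qd)ᵀ(Qe).
-- Pushing (d,e) forward along Q gives #{Y · sᵀ = 0} = K² · O; writing
-- (Qd)ᵀ(Qe) = d · (QᵀQ e) and summing over d first gives
-- 2 · #{Y · sᵀ = 0} = N² + N · K_G.  Together with K · C = N and
-- 2^rank(QᵀQ) · K_G = N, both identities follow by arithmetic.

open import Defs
open import Algebra.Bundles using (CommutativeRing)
open import Data.Bool using (Bool; true; false; _∧_; _∨_; _xor_; not; if_then_else_)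
open import Data.Bool.Properties
  using (xor-assoc; xor-comm; xor-same; xor-identityʳ; ∧-comm; ∧-identityʳ; ∨-identityʳ;
         ∧-distribʳ-xor; xor-∧-commutativeRing)
open import Data.Fin using (Fin)
open import Function.Base using (it)
open import Data.List using (List; []; _∷_; _++_; map; length; concatMap)
open import Data.List.Properties using (concatMap-++; concatMap-map)
open import Data.List.Membership.Propositional using (_∈_)
open import Data.List.Membership.Propositional.Properties using (∈-map⁺; ∈-++⁺ˡ; ∈-++⁺ʳ)
open import Data.List.Relation.Unary.Any using (here; there)
open import Data.Nat using (ℕ; zero; suc; _+_; _*_; _^_; _≤_; _≤?_; z≤n; s≤s; NonZero)
open import Data.Nat.Properties
open import Data.Nat.Solver using (module +-*-Solver)
open import Data.Product using (_×_; _,_; Σ; ∃)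
open import Data.Vec using (Vec; []; _∷_; zipWith; lookup; tabulate; toList)
open import Data.Vec.Properties
  using (zipWith-assoc; zipWith-comm; zipWith-identityˡ; zipWith-identityʳ; zipWith-distribʳ;
         lookup-zipWith; lookup-replicate; tabulate-∘; tabulate-cong; tabulate∘lookup)
open import Relation.Binary.PropositionalEquality
open import Relation.Nullary using (¬_; yes; no; contradiction)
open import Algebra.Properties.CommutativeSemigroup
  (CommutativeRing.+-commutativeSemigroup xor-∧-commutativeRing)
  using () renaming (interchange to xor-interchange)
open import Algebra.Properties.CommutativeSemigroup +-commutativeSemigroup
  using () renaming (interchange to +-interchange)
open +-*-Solver using (solve; _:+_; _:*_; _:=_; con)

private
  variable
    k m n : ℕ

⊕-assoc : (u v w : Vec Bool n) → (u ⊕ v) ⊕ w ≡ u ⊕ (v ⊕ w)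
⊕-assoc = zipWith-assoc xor-assoc

⊕-comm : (u v : Vec Bool n) → u ⊕ v ≡ v ⊕ u
⊕-comm = zipWith-comm xor-comm

⊕-identityˡ : (u : Vec Bool n) → vzero n ⊕ u ≡ u
⊕-identityˡ = zipWith-identityˡ (λ _ → refl)

⊕-identityʳ : (u : Vec Bool n) → u ⊕ vzero n ≡ u
⊕-identityʳ = zipWith-identityʳ xor-identityʳ

⊕-self : (u : Vec Bool n) → u ⊕ u ≡ vzero n
⊕-self [] = refl
⊕-self (a ∷ u) = cong₂ _∷_ (xor-same a) (⊕-self u)

⊕-cancelʳ : (u v : Vec Bool n) → (u ⊕ v) ⊕ v ≡ u
⊕-cancelʳ {n} u v = begin
  (u ⊕ v) ⊕ v   ≡⟨ ⊕-assoc u v v ⟩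
  u ⊕ (v ⊕ v)   ≡⟨ cong (u ⊕_) (⊕-self v) ⟩
  u ⊕ vzero n   ≡⟨ ⊕-identityʳ u ⟩
  u             ∎
  where open ≡-Reasoning

isZero⇒≡vzero : (u : Vec Bool n) → isZero u ≡ true → u ≡ vzero n
isZero⇒≡vzero [] _ = refl
isZero⇒≡vzero (false ∷ u) h = cong (false ∷_) (isZero⇒≡vzero u h)

isZero-vzero : (n : ℕ) → isZero (vzero n) ≡ true
isZero-vzero zero = refl
isZero-vzero (suc n) = isZero-vzero n

eqv⇒≡ : (u v : Vec Bool n) → eqv u v ≡ true → u ≡ v
eqv⇒≡ u v h = begin
  u               ≡⟨ sym (⊕-cancelʳ u v) ⟩
  (u ⊕ v) ⊕ v     ≡⟨ cong (_⊕ v) (isZero⇒≡vzero (u ⊕ v) h) ⟩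
  vzero _ ⊕ v     ≡⟨ ⊕-identityˡ v ⟩
  v               ∎
  where open ≡-Reasoning

eqv-refl : (u : Vec Bool n) → eqv u u ≡ true
eqv-refl {n} u = trans (cong isZero (⊕-self u)) (isZero-vzero n)

eqv-translate : (u c : Vec Bool n) → eqv (u ⊕ c) c ≡ isZero u
eqv-translate u c = cong isZero (⊕-cancelʳ u c)

dot-⊕ˡ : (u v w : Vec Bool n) → dot (u ⊕ v) w ≡ dot u w xor dot v w
dot-⊕ˡ [] [] [] = refl
dot-⊕ˡ (a ∷ u) (b ∷ v) (c ∷ w) = begin
  ((a xor b) ∧ c) xor dot (u ⊕ v) w
    ≡⟨ cong₂ _xor_ (∧-distribʳ-xor c a b) (dot-⊕ˡ u v w) ⟩
  ((a ∧ c) xor (b ∧ c)) xor (dot u w xor dot v w)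
    ≡⟨ xor-interchange (a ∧ c) (b ∧ c) (dot u w) (dot v w) ⟩
  ((a ∧ c) xor dot u w) xor ((b ∧ c) xor dot v w) ∎
  where open ≡-Reasoning

dot-comm : (u v : Vec Bool n) → dot u v ≡ dot v u
dot-comm [] [] = refl
dot-comm (a ∷ u) (b ∷ v) = cong₂ _xor_ (∧-comm a b) (dot-comm u v)

dot-⊕ʳ : (u v w : Vec Bool n) → dot w (u ⊕ v) ≡ dot w u xor dot w v
dot-⊕ʳ u v w = begin
  dot w (u ⊕ v)           ≡⟨ dot-comm w (u ⊕ v) ⟩
  dot (u ⊕ v) w           ≡⟨ dot-⊕ˡ u v w ⟩
  dot u w xor dot v w     ≡⟨ cong₂ _xor_ (dot-comm u w) (dot-comm v w) ⟩
  dot w u xor dot w v     ∎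
  where open ≡-Reasoning

dot-zeroˡ : (w : Vec Bool n) → dot (vzero n) w ≡ false
dot-zeroˡ [] = refl
dot-zeroˡ (a ∷ w) = dot-zeroˡ w

dot-zeroʳ : (w : Vec Bool n) → dot w (vzero n) ≡ false
dot-zeroʳ {n} w = trans (dot-comm w (vzero n)) (dot-zeroˡ w)

_·_ : Bool → Vec Bool n → Vec Bool n
_·_ {n} a p = if a then p else vzero n

·-pull : (g : Vec Bool n → Bool) → g (vzero n) ≡ false → (a : Bool) (p : Vec Bool n) →
         g (a · p) ≡ a ∧ g p
·-pull g g0 true p = refl
·-pull g g0 false p = g0

_∧v_ : Vec Bool n → Vec Bool n → Vec Bool n
_∧v_ = zipWith _∧_

∧v-distrib-⊕ : (x y S : Vec Bool n) → (x ⊕ y) ∧v S ≡ (x ∧v S) ⊕ (y ∧v S)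
∧v-distrib-⊕ x y S = zipWith-distribʳ ∧-distribʳ-xor S x y

∧v-subsetOf : (x S : Vec Bool n) → subsetOf (x ∧v S) S ≡ true
∧v-subsetOf [] [] = refl
∧v-subsetOf (false ∷ x) (b ∷ S) = ∧v-subsetOf x S
∧v-subsetOf (true ∷ x) (false ∷ S) = ∧v-subsetOf x S
∧v-subsetOf (true ∷ x) (true ∷ S) = ∧v-subsetOf x S

subsetOf⇒∧v-id : (x S : Vec Bool n) → subsetOf x S ≡ true → x ∧v S ≡ x
subsetOf⇒∧v-id [] [] h = refl
subsetOf⇒∧v-id (false ∷ x) (false ∷ S) h = cong (false ∷_) (subsetOf⇒∧v-id x S h)
subsetOf⇒∧v-id (false ∷ x) (true ∷ S) h = cong (false ∷_) (subsetOf⇒∧v-id x S h)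
subsetOf⇒∧v-id (true ∷ x) (true ∷ S) h = cong (true ∷_) (subsetOf⇒∧v-id x S h)

-- f is linear; over F₂ additivity is all that is needed.
Linear : (Vec Bool n → Vec Bool m) → Set
Linear {n} f = (x y : Vec Bool n) → f (x ⊕ y) ≡ f x ⊕ f y

linear-zero : (f : Vec Bool n → Vec Bool m) → Linear f → f (vzero n) ≡ vzero m
linear-zero {n} f lin = begin
  f (vzero n)                 ≡⟨ cong f (sym (⊕-self (vzero n))) ⟩
  f (vzero n ⊕ vzero n)       ≡⟨ lin (vzero n) (vzero n) ⟩
  f (vzero n) ⊕ f (vzero n)   ≡⟨ ⊕-self (f (vzero n)) ⟩
  vzero _                     ∎
  where open ≡-Reasoning

linear-split : (f : Vec Bool (suc n) → Vec Bool m) → Linear f → (b : Bool) (z : Vec Bool n) →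
               f (b ∷ z) ≡ f (b ∷ vzero n) ⊕ f (false ∷ z)
linear-split {n} f lin b z =
  trans (cong f (cong₂ _∷_ (sym (xor-identityʳ b)) (sym (⊕-identityˡ z))))
        (lin (b ∷ vzero n) (false ∷ z))

mulVec-linear : (M : Mat n) → Linear (mulVec M)
mulVec-linear [] x y = refl
mulVec-linear (p ∷ M) x y = cong₂ _∷_ (dot-⊕ʳ x y p) (mulVec-linear M x y)

-- Sums over the cube F₂ᵏ

𝟙 : Bool → ℕ
𝟙 b = if b then 1 else 0

sumCube : (k : ℕ) → (Vec Bool k → ℕ) → ℕ
sumCube zero f = f []
sumCube (suc k) f = sumCube k (λ x → f (false ∷ x)) + sumCube k (λ x → f (true ∷ x))

sumCube-cong : (k : ℕ) {f g : Vec Bool k → ℕ} → (∀ x → f x ≡ g x) → sumCube k f ≡ sumCube k g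
sumCube-cong zero h = h []
sumCube-cong (suc k) h =
  cong₂ _+_ (sumCube-cong k (λ x → h (false ∷ x))) (sumCube-cong k (λ x → h (true ∷ x)))

sumCube-+ : (k : ℕ) (f g : Vec Bool k → ℕ) →
            sumCube k (λ x → f x + g x) ≡ sumCube k f + sumCube k g
sumCube-+ zero f g = refl
sumCube-+ (suc k) f g =
  trans (cong₂ _+_ (sumCube-+ k (λ x → f (false ∷ x)) (λ x → g (false ∷ x)))
                   (sumCube-+ k (λ x → f (true ∷ x)) (λ x → g (true ∷ x))))
        (+-interchange (sumCube k (λ x → f (false ∷ x))) (sumCube k (λ x → g (false ∷ x)))
                       (sumCube k (λ x → f (true ∷ x))) (sumCube k (λ x → g (true ∷ x))))

sumCube-*ˡ : (k : ℕ) (c : ℕ) (f : Vec Bool k → ℕ) → sumCube k (λ x → c * f x) ≡ c * sumCube k f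
sumCube-*ˡ zero c f = refl
sumCube-*ˡ (suc k) c f =
  trans (cong₂ _+_ (sumCube-*ˡ k c (λ x → f (false ∷ x))) (sumCube-*ˡ k c (λ x → f (true ∷ x))))
        (sym (*-distribˡ-+ c _ _))

sumCube-const : (k c : ℕ) → sumCube k (λ _ → c) ≡ c * 2 ^ k
sumCube-const zero c = sym (*-identityʳ c)
sumCube-const (suc k) c rewrite sumCube-const k c =
  solve 2 (λ c t → c :* t :+ c :* t := c :* (con 2 :* t)) refl c (2 ^ k)

sumCube-swap : (k j : ℕ) (f : Vec Bool k → Vec Bool j → ℕ) →
  sumCube k (λ x → sumCube j (λ y → f x y)) ≡ sumCube j (λ y → sumCube k (λ x → f x y))
sumCube-swap zero j f = refl
sumCube-swap (suc k) j f =
  trans (cong₂ _+_ (sumCube-swap k j (λ x → f (false ∷ x))) (sumCube-swap k j (λ x → f (true ∷ x))))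
        (sym (sumCube-+ j (λ y → sumCube k (λ x → f (false ∷ x) y))
                          (λ y → sumCube k (λ x → f (true ∷ x) y))))

sumCube-mono : (k : ℕ) {f g : Vec Bool k → ℕ} → (∀ x → f x ≤ g x) → sumCube k f ≤ sumCube k g
sumCube-mono zero h = h []
sumCube-mono (suc k) h =
  +-mono-≤ (sumCube-mono k (λ x → h (false ∷ x))) (sumCube-mono k (λ x → h (true ∷ x)))

-- Translation invariance: x ↦ x ⊕ a permutes the cube.
sumCube-translate : (k : ℕ) (f : Vec Bool k → ℕ) (a : Vec Bool k) →
                    sumCube k (λ x → f (x ⊕ a)) ≡ sumCube k f
sumCube-translate zero f [] = refl
sumCube-translate (suc k) f (false ∷ a) =
  cong₂ _+_ (sumCube-translate k (λ x → f (false ∷ x)) a)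
            (sumCube-translate k (λ x → f (true ∷ x)) a)
sumCube-translate (suc k) f (true ∷ a) =
  trans (cong₂ _+_ (sumCube-translate k (λ x → f (true ∷ x)) a)
                   (sumCube-translate k (λ x → f (false ∷ x)) a))
        (+-comm (sumCube k (λ x → f (true ∷ x))) (sumCube k (λ x → f (false ∷ x))))

sumCube-delta : (k : ℕ) (y : Vec Bool k) (g : Vec Bool k → ℕ) →
                sumCube k (λ c → if eqv y c then g c else 0) ≡ g y
sumCube-delta zero [] g = refl
sumCube-delta (suc k) (false ∷ y) g
  rewrite sumCube-delta k y (λ c → g (false ∷ c)) | sumCube-const k 0 = +-identityʳ _
sumCube-delta (suc k) (true ∷ y) g
  rewrite sumCube-delta k y (λ c → g (true ∷ c)) | sumCube-const k 0 = refl

count-++ : {A : Set} (p : A → Bool) (xs ys : List A) → count p (xs ++ ys) ≡ count p xs + count p ys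
count-++ p [] ys = refl
count-++ p (x ∷ xs) ys = trans (cong (𝟙 (p x) +_) (count-++ p xs ys)) (sym (+-assoc (𝟙 (p x)) _ _))

count-map : {A B : Set} (p : B → Bool) (h : A → B) (xs : List A) →
            count p (map h xs) ≡ count (λ x → p (h x)) xs
count-map p h [] = refl
count-map p h (x ∷ xs) = cong (𝟙 (p (h x)) +_) (count-map p h xs)

count-allVecs : (k : ℕ) (p : Vec Bool k → Bool) → count p (allVecs k) ≡ sumCube k (λ x → 𝟙 (p x))
count-allVecs zero p = +-identityʳ (𝟙 (p []))
count-allVecs (suc k) p = begin
  count p (map (false ∷_) (allVecs k) ++ map (true ∷_) (allVecs k))
    ≡⟨ count-++ p (map (false ∷_) (allVecs k)) (map (true ∷_) (allVecs k)) ⟩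
  count p (map (false ∷_) (allVecs k)) + count p (map (true ∷_) (allVecs k))
    ≡⟨ cong₂ _+_ (count-map p (false ∷_) (allVecs k)) (count-map p (true ∷_) (allVecs k)) ⟩
  count (λ x → p (false ∷ x)) (allVecs k) + count (λ x → p (true ∷ x)) (allVecs k)
    ≡⟨ cong₂ _+_ (count-allVecs k (λ x → p (false ∷ x))) (count-allVecs k (λ x → p (true ∷ x))) ⟩
  sumCube (suc k) (λ x → 𝟙 (p x)) ∎
  where open ≡-Reasoning

count-concatMap-allVecs : {B : Set} (k : ℕ) (p : B → Bool) (f : Vec Bool k → List B) →
  count p (concatMap f (allVecs k)) ≡ sumCube k (λ x → count p (f x))
count-concatMap-allVecs zero p f = trans (count-++ p (f []) []) (+-identityʳ _)
count-concatMap-allVecs (suc k) p f = begin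
  count p (concatMap f (map (false ∷_) (allVecs k) ++ map (true ∷_) (allVecs k)))
    ≡⟨ cong (count p) (concatMap-++ f (map (false ∷_) (allVecs k)) (map (true ∷_) (allVecs k))) ⟩
  count p (concatMap f (map (false ∷_) (allVecs k)) ++ concatMap f (map (true ∷_) (allVecs k)))
    ≡⟨ count-++ p (concatMap f (map (false ∷_) (allVecs k))) (concatMap f (map (true ∷_) (allVecs k))) ⟩
  count p (concatMap f (map (false ∷_) (allVecs k))) + count p (concatMap f (map (true ∷_) (allVecs k)))
    ≡⟨ cong₂ (λ u v → count p u + count p v) (concatMap-map f (false ∷_) (allVecs k))
                                              (concatMap-map f (true ∷_) (allVecs k)) ⟩
  count p (concatMap (λ x → f (false ∷ x)) (allVecs k)) + count p (concatMap (λ x → f (true ∷ x)) (allVecs k))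
    ≡⟨ cong₂ _+_ (count-concatMap-allVecs k p (λ x → f (false ∷ x)))
                 (count-concatMap-allVecs k p (λ x → f (true ∷ x))) ⟩
  sumCube (suc k) (λ x → count p (f x)) ∎
  where open ≡-Reasoning

count-allPairs : (k : ℕ) (p : Vec Bool k × Vec Bool k → Bool) →
  count p (allPairs k) ≡ sumCube k (λ d → sumCube k (λ e → 𝟙 (p (d , e))))
count-allPairs k p =
  trans (count-concatMap-allVecs k p (λ d → map (λ e → d , e) (allVecs k)))
        (sumCube-cong k (λ d → trans (count-map p (λ e → d , e) (allVecs k))
                                     (count-allVecs k (λ e → p (d , e)))))

allVecs-complete : (x : Vec Bool n) → x ∈ allVecs n
allVecs-complete [] = here refl
allVecs-complete {suc n} (false ∷ x) = ∈-++⁺ˡ (∈-map⁺ (false ∷_) (allVecs-complete x))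
allVecs-complete {suc n} (true ∷ x) =
  ∈-++⁺ʳ (map (false ∷_) (allVecs n)) (∈-map⁺ (true ∷_) (allVecs-complete x))

anyB-intro : {A : Set} (p : A → Bool) {x : A} {xs : List A} → x ∈ xs → p x ≡ true → anyB p xs ≡ true
anyB-intro p (here refl) px rewrite px = refl
anyB-intro p {xs = y ∷ ys} (there x∈ys) px rewrite anyB-intro p x∈ys px with p y
... | true = refl
... | false = refl

anyB-witness : {A : Set} (p : A → Bool) (xs : List A) → anyB p xs ≡ true → ∃ λ x → p x ≡ true
anyB-witness p (x ∷ xs) h with p x in px
... | true = x , px
... | false = anyB-witness p xs h

allB-intro : {A : Set} (p : A → Bool) (xs : List A) → (∀ x → p x ≡ true) → allB p xs ≡ true
allB-intro p [] h = refl
allB-intro p (x ∷ xs) h rewrite h x = allB-intro p xs h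

allB-elim : {A : Set} (p : A → Bool) {x : A} {xs : List A} → allB p xs ≡ true → x ∈ xs → p x ≡ true
allB-elim p {xs = y ∷ ys} h (here refl) with p y
... | true = refl
allB-elim p {xs = y ∷ ys} h (there x∈ys) with p y
... | true = allB-elim p h x∈ys

maxL-≥ : {A : Set} (h : A → ℕ) {x : A} {xs : List A} → x ∈ xs → h x ≤ maxL (map h xs)
maxL-≥ h {xs = y ∷ ys} (here refl) = m≤m⊔n (h y) _
maxL-≥ h {xs = y ∷ ys} (there x∈ys) = ≤-trans (maxL-≥ h x∈ys) (m≤n⊔m (h y) _)

maxL-≤ : {A : Set} (h : A → ℕ) (b : ℕ) (xs : List A) → (∀ x → h x ≤ b) → maxL (map h xs) ≤ b
maxL-≤ h b [] H = z≤n
maxL-≤ h b (x ∷ xs) H = ⊔-lub (H x) (maxL-≤ h b xs H)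

-- Kernel and image of a linear map

-- c ∈ im f, decided by search; for f = mulVec M this is inCode M.
inImage : (Vec Bool n → Vec Bool m) → Vec Bool m → Bool
inImage {n} f c = anyB (λ x → eqv (f x) c) (allVecs n)

inImage-intro : (f : Vec Bool n → Vec Bool m) (x : Vec Bool n) → inImage f (f x) ≡ true
inImage-intro f x = anyB-intro (λ y → eqv (f y) (f x)) (allVecs-complete x) (eqv-refl (f x))

inImage-witness : (f : Vec Bool n → Vec Bool m) (c : Vec Bool m) →
                  inImage f c ≡ true → ∃ λ x → f x ≡ c
inImage-witness {n} f c h with anyB-witness (λ x → eqv (f x) c) (allVecs n) h
... | x , fx≈c = x , eqv⇒≡ (f x) c fx≈c

kernelSize : (Vec Bool n → Vec Bool m) → ℕ
kernelSize {n} f = sumCube n (λ x → 𝟙 (isZero (f x)))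

imageSize : (Vec Bool n → Vec Bool m) → ℕ
imageSize {m = m} f = sumCube m (λ c → 𝟙 (inImage f c))

onImage : (Vec Bool n → Vec Bool m) → (Vec Bool m → ℕ) → Vec Bool m → ℕ
onImage f g c = if inImage f c then g c else 0

-- Every fibre of a linear map is empty or a translate of the kernel.
fibreSize : (f : Vec Bool n → Vec Bool m) → Linear f → (c : Vec Bool m) →
            sumCube n (λ x → 𝟙 (eqv (f x) c)) ≡ onImage f (λ _ → kernelSize f) c
fibreSize {n} f lin c with inImage f c in c∈im
... | true with inImage-witness f c c∈im
...   | x₀ , fx₀≡c = begin
  sumCube n (λ x → 𝟙 (eqv (f x) c))          ≡⟨ sym (sumCube-translate n _ x₀) ⟩
  sumCube n (λ x → 𝟙 (eqv (f (x ⊕ x₀)) c))   ≡⟨ sumCube-cong n (λ x → cong 𝟙 (shift x)) ⟩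
  kernelSize f                                ∎
  where
  open ≡-Reasoning
  shift : ∀ x → eqv (f (x ⊕ x₀)) c ≡ isZero (f x)
  shift x = trans (cong (λ v → eqv v c) (trans (lin x x₀) (cong (f x ⊕_) fx₀≡c)))
                  (eqv-translate (f x) c)
fibreSize {n} f lin c | false = trans (sumCube-cong n outside) (sumCube-const n 0)
  where
  outside : ∀ x → 𝟙 (eqv (f x) c) ≡ 0
  outside x with eqv (f x) c in fx≈c
  ... | false = refl
  ... | true with trans (sym c∈im) (subst (λ v → inImage f v ≡ true) (eqv⇒≡ (f x) c fx≈c)
                                           (inImage-intro f x))
  ...   | ()

sumCube-linear : (f : Vec Bool n → Vec Bool m) → Linear f → (g : Vec Bool m → ℕ) →
                 sumCube n (λ x → g (f x)) ≡ kernelSize f * sumCube m (onImage f g)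
sumCube-linear {n} {m} f lin g = begin
  sumCube n (λ x → g (f x))
    ≡⟨ sumCube-cong n (λ x → sym (sumCube-delta m (f x) g)) ⟩
  sumCube n (λ x → sumCube m (λ c → if eqv (f x) c then g c else 0))
    ≡⟨ sumCube-swap n m _ ⟩
  sumCube m (λ c → sumCube n (λ x → if eqv (f x) c then g c else 0))
    ≡⟨ sumCube-cong m (λ c → trans (sumCube-cong n (λ x → if-as-* (eqv (f x) c) (g c)))
                                   (sumCube-*ˡ n (g c) (λ x → 𝟙 (eqv (f x) c)))) ⟩
  sumCube m (λ c → g c * sumCube n (λ x → 𝟙 (eqv (f x) c)))
    ≡⟨ sumCube-cong m (λ c → trans (cong (g c *_) (fibreSize f lin c)) (weight-onImage c)) ⟩
  sumCube m (λ c → kernelSize f * onImage f g c)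
    ≡⟨ sumCube-*ˡ m (kernelSize f) (onImage f g) ⟩
  kernelSize f * sumCube m (onImage f g) ∎
  where
  open ≡-Reasoning
  if-as-* : (b : Bool) (a : ℕ) → (if b then a else 0) ≡ a * 𝟙 b
  if-as-* true a = sym (*-identityʳ a)
  if-as-* false a = sym (*-zeroʳ a)
  weight-onImage : ∀ c → g c * onImage f (λ _ → kernelSize f) c ≡ kernelSize f * onImage f g c
  weight-onImage c with inImage f c
  ... | true = *-comm (g c) (kernelSize f)
  ... | false = trans (*-zeroʳ (g c)) (sym (*-zeroʳ (kernelSize f)))

sumCube²-linear : (f : Vec Bool n → Vec Bool m) → Linear f → (g : Vec Bool m → Vec Bool m → ℕ) →
  sumCube n (λ d → sumCube n (λ e → g (f d) (f e)))
  ≡ kernelSize f * (kernelSize f *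
      sumCube m (λ c₁ → sumCube m (λ c₂ → onImage f (λ c → onImage f (g c) c₂) c₁)))
sumCube²-linear {n} {m} f lin g = begin
  sumCube n (λ d → sumCube n (λ e → g (f d) (f e)))
    ≡⟨ sumCube-cong n (λ d → sumCube-linear f lin (g (f d))) ⟩
  sumCube n (λ d → K * sumCube m (λ c₂ → onImage f (g (f d)) c₂))
    ≡⟨ sumCube-*ˡ n K _ ⟩
  K * sumCube n (λ d → sumCube m (λ c₂ → onImage f (g (f d)) c₂))
    ≡⟨ cong (K *_) (sumCube-swap n m _) ⟩
  K * sumCube m (λ c₂ → sumCube n (λ d → onImage f (g (f d)) c₂))
    ≡⟨ cong (K *_) (sumCube-cong m (λ c₂ → sumCube-linear f lin (λ c → onImage f (g c) c₂))) ⟩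
  K * sumCube m (λ c₂ → K * sumCube m (λ c₁ → onImage f (λ c → onImage f (g c) c₂) c₁))
    ≡⟨ cong (K *_) (sumCube-*ˡ m K _) ⟩
  K * (K * sumCube m (λ c₂ → sumCube m (λ c₁ → onImage f (λ c → onImage f (g c) c₂) c₁)))
    ≡⟨ cong (λ t → K * (K * t)) (sumCube-swap m m _) ⟩
  K * (K * sumCube m (λ c₁ → sumCube m (λ c₂ → onImage f (λ c → onImage f (g c) c₂) c₁))) ∎
  where
  open ≡-Reasoning
  K : ℕ
  K = kernelSize f

kernel-image : (f : Vec Bool n → Vec Bool m) → Linear f → kernelSize f * imageSize f ≡ 2 ^ n
kernel-image {n} {m} f lin = begin
  kernelSize f * imageSize f                     ≡⟨⟩
  kernelSize f * sumCube m (onImage f (λ _ → 1)) ≡⟨ sym (sumCube-linear f lin (λ _ → 1)) ⟩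
  sumCube n (λ _ → 1)                            ≡⟨ sumCube-const n 1 ⟩
  1 * 2 ^ n                                      ≡⟨ *-identityˡ (2 ^ n) ⟩
  2 ^ n                                          ∎
  where open ≡-Reasoning

-- Rank of a linear map

-- The column-independence test and the rank of Defs, for an arbitrary
-- linear map; for f = mulVec M they are colsIndep M and rank M.
independentᵇ : (Vec Bool n → Vec Bool m) → Vec Bool n → Bool
independentᵇ {n} f S = allB (λ x → not (subsetOf x S) ∨ isZero x ∨ not (isZero (f x))) (allVecs n)

rankOf : (Vec Bool n → Vec Bool m) → ℕ
rankOf {n} f = maxL (map (λ S → if independentᵇ f S then weight S else 0) (allVecs n))

-- The unit vectors indexed by T are independent, resp. span im f.
Independent : (Vec Bool n → Vec Bool m) → Vec Bool n → Set
Independent f T = ∀ x → subsetOf x T ≡ true → isZero (f x) ≡ true → isZero x ≡ true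

Spans : (Vec Bool n → Vec Bool m) → Vec Bool n → Set
Spans f T = ∀ x → ∃ λ y → f (y ∧v T) ≡ f x

independentᵇ⇒Independent : (f : Vec Bool n → Vec Bool m) (S : Vec Bool n) →
                           independentᵇ f S ≡ true → Independent f S
independentᵇ⇒Independent f S h x x⊆S fx≡0 =
  trans (sym (∨-identityʳ (isZero x)))
        (subst₂ (λ a b → not a ∨ isZero x ∨ not b ≡ true) x⊆S fx≡0
                (allB-elim _ h (allVecs-complete x)))

Independent⇒independentᵇ : (f : Vec Bool n → Vec Bool m) (T : Vec Bool n) →
                           Independent f T → independentᵇ f T ≡ true
Independent⇒independentᵇ {n} f T indep = allB-intro _ (allVecs n) clause
  where
  clause : ∀ x → (not (subsetOf x T) ∨ isZero x ∨ not (isZero (f x))) ≡ true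
  clause x with subsetOf x T in x⊆T | isZero x in x≡0 | isZero (f x) in fx≡0
  ... | false | _     | _     = refl
  ... | true  | true  | _     = refl
  ... | true  | false | false = refl
  ... | true  | false | true  with trans (sym x≡0) (indep x x⊆T fx≡0)
  ...   | ()

-- Induction on n: extend a basis T of f restricted to {x₁ = 0} by the first
-- unit vector e₁ exactly when f e₁ is not already spanned.
basis-skip : (f : Vec Bool (suc n) → Vec Bool m) → Linear f → (T : Vec Bool n) →
             Independent (λ x → f (false ∷ x)) T → Spans (λ x → f (false ∷ x)) T →
             (∃ λ y → f (false ∷ (y ∧v T)) ≡ f (true ∷ vzero n)) →
             Independent f (false ∷ T) × Spans f (false ∷ T)
basis-skip {n} f lin T indep spans (y₀ , fy₀≡fe₁) = indep′ , spans′
  where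
  indep′ : Independent f (false ∷ T)
  indep′ (false ∷ x) = indep x
  spans′ : Spans f (false ∷ T)
  spans′ (false ∷ x) = let (y , fy≡fx) = spans x in (false ∷ y) , fy≡fx
  spans′ (true ∷ x) = let (y , fy≡fx) = spans x in (false ∷ (y₀ ⊕ y)) , (begin
    f (false ∷ ((y₀ ⊕ y) ∧v T))                       ≡⟨ cong (λ z → f (false ∷ z)) (∧v-distrib-⊕ y₀ y T) ⟩
    f (false ∷ ((y₀ ∧v T) ⊕ (y ∧v T)))                ≡⟨ lin (false ∷ (y₀ ∧v T)) (false ∷ (y ∧v T)) ⟩
    f (false ∷ (y₀ ∧v T)) ⊕ f (false ∷ (y ∧v T))      ≡⟨ cong₂ _⊕_ fy₀≡fe₁ fy≡fx ⟩
    f (true ∷ vzero n) ⊕ f (false ∷ x)                ≡⟨ sym (linear-split f lin true x) ⟩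
    f (true ∷ x)                                      ∎)
    where open ≡-Reasoning

basis-take : (f : Vec Bool (suc n) → Vec Bool m) → Linear f → (T : Vec Bool n) →
             Independent (λ x → f (false ∷ x)) T → Spans (λ x → f (false ∷ x)) T →
             ¬ (∃ λ y → f (false ∷ (y ∧v T)) ≡ f (true ∷ vzero n)) →
             Independent f (true ∷ T) × Spans f (true ∷ T)
basis-take {n} f lin T indep spans fe₁∉span = indep′ , spans′
  where
  indep′ : Independent f (true ∷ T)
  indep′ (false ∷ x) = indep x
  indep′ (true ∷ x) x⊆T fx≡0 = contradiction (x , (begin
    f (false ∷ (x ∧v T))                     ≡⟨ cong (λ z → f (false ∷ z)) (subsetOf⇒∧v-id x T x⊆T) ⟩
    f (false ∷ x)                            ≡⟨ sym (⊕-cancelʳ (f (false ∷ x)) (f (true ∷ vzero n))) ⟩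
    (f (false ∷ x) ⊕ f (true ∷ vzero n)) ⊕ f (true ∷ vzero n)
      ≡⟨ cong (_⊕ f (true ∷ vzero n)) (trans (⊕-comm _ _) (sym (linear-split f lin true x))) ⟩
    f (true ∷ x) ⊕ f (true ∷ vzero n)        ≡⟨ cong (_⊕ f (true ∷ vzero n)) (isZero⇒≡vzero _ fx≡0) ⟩
    vzero _ ⊕ f (true ∷ vzero n)             ≡⟨ ⊕-identityˡ _ ⟩
    f (true ∷ vzero n)                       ∎)) fe₁∉span
    where open ≡-Reasoning
  spans′ : Spans f (true ∷ T)
  spans′ (b ∷ x) = let (y , fy≡fx) = spans x in (b ∷ y) , (begin
    f ((b ∧ true) ∷ (y ∧v T))                 ≡⟨ cong (λ a → f (a ∷ (y ∧v T))) (∧-identityʳ b) ⟩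
    f (b ∷ (y ∧v T))                          ≡⟨ linear-split f lin b (y ∧v T) ⟩
    f (b ∷ vzero n) ⊕ f (false ∷ (y ∧v T))    ≡⟨ cong (f (b ∷ vzero n) ⊕_) fy≡fx ⟩
    f (b ∷ vzero n) ⊕ f (false ∷ x)           ≡⟨ sym (linear-split f lin b x) ⟩
    f (b ∷ x)                                 ∎)
    where open ≡-Reasoning

basis : (f : Vec Bool n → Vec Bool m) → Linear f → Σ (Vec Bool n) λ T → Independent f T × Spans f T
basis {zero} f lin = [] , (λ { [] _ _ → refl }) , (λ { [] → [] , refl })
basis {suc n} {m} f lin with basis (λ x → f (false ∷ x)) (λ x y → lin (false ∷ x) (false ∷ y))
... | T , indep , spans with inImage (λ y → f (false ∷ (y ∧v T))) (f (true ∷ vzero n)) in fe₁∈span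
...   | true = (false ∷ T) , basis-skip f lin T indep spans (inImage-witness _ _ fe₁∈span)
...   | false = (true ∷ T) , basis-take f lin T indep spans fe₁∉span
  where
  fT : Vec Bool n → Vec Bool m
  fT y = f (false ∷ (y ∧v T))
  fe₁∉span : ¬ (∃ λ y → fT y ≡ f (true ∷ vzero n))
  fe₁∉span (y , fy≡fe₁) with trans (sym fe₁∈span)
    (subst (λ c → inImage fT c ≡ true) fy≡fe₁ (inImage-intro fT y))
  ... | ()

restrict : (Vec Bool n → Vec Bool m) → Vec Bool n → Vec Bool n → Vec Bool m
restrict f S x = f (x ∧v S)

restrict-linear : (f : Vec Bool n → Vec Bool m) → Linear f → (S : Vec Bool n) → Linear (restrict f S)
restrict-linear f lin S x y = trans (cong f (∧v-distrib-⊕ x y S)) (lin (x ∧v S) (y ∧v S))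

imageSize-restrict-≤ : (f : Vec Bool n → Vec Bool m) (S : Vec Bool n) → imageSize (restrict f S) ≤ imageSize f
imageSize-restrict-≤ {m = m} f S = sumCube-mono m included
  where
  included : ∀ c → 𝟙 (inImage (restrict f S) c) ≤ 𝟙 (inImage f c)
  included c with inImage (restrict f S) c in c∈im
  ... | false = z≤n
  ... | true with inImage-witness (restrict f S) c c∈im
  ...   | x , fx≡c rewrite subst (λ v → inImage f v ≡ true) fx≡c (inImage-intro f (x ∧v S)) = s≤s z≤n

spans⇒imageSize-≤ : (f : Vec Bool n → Vec Bool m) (T : Vec Bool n) → Spans f T →
                    imageSize f ≤ imageSize (restrict f T)
spans⇒imageSize-≤ {m = m} f T spans = sumCube-mono m included
  where
  included : ∀ c → 𝟙 (inImage f c) ≤ 𝟙 (inImage (restrict f T) c)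
  included c with inImage f c in c∈im
  ... | false = z≤n
  ... | true with inImage-witness f c c∈im
  ...   | x , fx≡c with spans x
  ...     | y , fy≡fx rewrite subst (λ v → inImage (restrict f T) v ≡ true) (trans fy≡fx fx≡c)
                                       (inImage-intro (restrict f T) y) = s≤s z≤n

mask-kernel : (S : Vec Bool n) → kernelSize (_∧v S) * 2 ^ weight S ≡ 2 ^ n
mask-kernel [] = refl
mask-kernel {suc n} (false ∷ S) = begin
  (Z + Z) * 2 ^ weight S                  ≡⟨ *-distribʳ-+ (2 ^ weight S) Z Z ⟩
  Z * 2 ^ weight S + Z * 2 ^ weight S     ≡⟨ cong₂ _+_ (mask-kernel S) (mask-kernel S) ⟩
  2 ^ n + 2 ^ n                           ≡⟨ cong (2 ^ n +_) (sym (+-identityʳ (2 ^ n))) ⟩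
  2 ^ suc n                               ∎
  where
  open ≡-Reasoning
  Z : ℕ
  Z = kernelSize (_∧v S)
mask-kernel {suc n} (true ∷ S) = begin
  (Z + sumCube n (λ _ → 0)) * (2 * 2 ^ weight S)   ≡⟨ cong (λ t → (Z + t) * (2 * 2 ^ weight S)) (sumCube-const n 0) ⟩
  (Z + 0) * (2 * 2 ^ weight S)                     ≡⟨ solve 2 (λ z t → (z :+ con 0) :* (con 2 :* t) := con 2 :* (z :* t)) refl Z (2 ^ weight S) ⟩
  2 * (Z * 2 ^ weight S)                           ≡⟨ cong (2 *_) (mask-kernel S) ⟩
  2 ^ suc n                                        ∎
  where
  open ≡-Reasoning
  Z : ℕ
  Z = kernelSize (_∧v S)

factor-nonZero : (a b c : ℕ) → a * b ≡ c → .{{NonZero c}} → NonZero a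
factor-nonZero a b c ab≡c = m*n≢0⇒m≢0 a {{subst NonZero (sym ab≡c) it}}

-- An independent S spans a subspace of size 2^|S|: restricted to S, f has
-- the same kernel as the mask, whose size is known.
independent-imageSize : (f : Vec Bool n → Vec Bool m) → Linear f → (S : Vec Bool n) →
                        Independent f S → imageSize (restrict f S) ≡ 2 ^ weight S
independent-imageSize {n} {m} f lin S indep =
  *-cancelˡ-≡ (imageSize (restrict f S)) (2 ^ weight S) Z {{Z≢0}} (begin
    Z * imageSize (restrict f S)
      ≡⟨ cong (_* imageSize (restrict f S)) (sym same-kernel) ⟩
    kernelSize (restrict f S) * imageSize (restrict f S)
      ≡⟨ kernel-image (restrict f S) (restrict-linear f lin S) ⟩
    2 ^ n
      ≡⟨ sym (mask-kernel S) ⟩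
    Z * 2 ^ weight S ∎)
  where
  open ≡-Reasoning
  Z : ℕ
  Z = kernelSize (_∧v S)
  Z≢0 : NonZero Z
  Z≢0 = factor-nonZero Z (2 ^ weight S) (2 ^ n) (mask-kernel S) {{m^n≢0 2 n}}
  in-kernel : ∀ x → 𝟙 (isZero (f (x ∧v S))) ≡ 𝟙 (isZero (x ∧v S))
  in-kernel x with isZero (x ∧v S) in xS≡0
  ... | true = cong 𝟙 (begin
    isZero (f (x ∧v S))    ≡⟨ cong (λ v → isZero (f v)) (isZero⇒≡vzero (x ∧v S) xS≡0) ⟩
    isZero (f (vzero n))   ≡⟨ cong isZero (linear-zero f lin) ⟩
    isZero (vzero m)       ≡⟨ isZero-vzero m ⟩
    true                   ∎)
  ... | false with isZero (f (x ∧v S)) in fxS≡0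
  ...   | false = refl
  ...   | true with trans (sym xS≡0) (indep (x ∧v S) (∧v-subsetOf x S) fxS≡0)
  ...     | ()
  same-kernel : kernelSize (restrict f S) ≡ Z
  same-kernel = sumCube-cong n in-kernel

independent-imageSize-≤ : (f : Vec Bool n → Vec Bool m) → Linear f → (S : Vec Bool n) →
                          Independent f S → 2 ^ weight S ≤ imageSize f
independent-imageSize-≤ f lin S indep =
  ≤-trans (≤-reflexive (sym (independent-imageSize f lin S indep))) (imageSize-restrict-≤ f S)

imageSize-basis : (f : Vec Bool n → Vec Bool m) → Linear f → (T : Vec Bool n) →
                  Independent f T → Spans f T → imageSize f ≡ 2 ^ weight T
imageSize-basis f lin T indep spans =
  ≤-antisym (≤-trans (spans⇒imageSize-≤ f T spans) (≤-reflexive (independent-imageSize f lin T indep)))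
            (independent-imageSize-≤ f lin T indep)

2^-reflects-≤ : (a b : ℕ) → 2 ^ a ≤ 2 ^ b → a ≤ b
2^-reflects-≤ a b 2^a≤2^b with a ≤? b
... | yes a≤b = a≤b
... | no a≰b = contradiction 2^a≤2^b (<⇒≱ (^-monoʳ-< 2 (s≤s (s≤s z≤n)) (≰⇒> a≰b)))

rankOf-basis : (f : Vec Bool n → Vec Bool m) → Linear f → (T : Vec Bool n) →
               Independent f T → Spans f T → rankOf f ≡ weight T
rankOf-basis {n} f lin T indep spans =
  ≤-antisym (maxL-≤ candidate (weight T) (allVecs n) bounded)
            (subst (λ b → (if b then weight T else 0) ≤ rankOf f)
                   (Independent⇒independentᵇ f T indep) (maxL-≥ candidate (allVecs-complete T)))
  where
  candidate : Vec Bool n → ℕ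
  candidate S = if independentᵇ f S then weight S else 0
  bounded : ∀ S → candidate S ≤ weight T
  bounded S with independentᵇ f S in S-indep
  ... | false = z≤n
  ... | true = 2^-reflects-≤ (weight S) (weight T)
    (≤-trans (independent-imageSize-≤ f lin S (independentᵇ⇒Independent f S S-indep))
             (≤-reflexive (imageSize-basis f lin T indep spans)))

rank-kernel : (f : Vec Bool n → Vec Bool m) → Linear f → 2 ^ rankOf f * kernelSize f ≡ 2 ^ n
rank-kernel {n} f lin with basis f lin
... | T , indep , spans = begin
  2 ^ rankOf f * kernelSize f    ≡⟨ cong (λ r → 2 ^ r * kernelSize f) (rankOf-basis f lin T indep spans) ⟩
  2 ^ weight T * kernelSize f    ≡⟨ cong (_* kernelSize f) (sym (imageSize-basis f lin T indep spans)) ⟩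
  imageSize f * kernelSize f     ≡⟨ *-comm (imageSize f) (kernelSize f) ⟩
  kernelSize f * imageSize f     ≡⟨ kernel-image f lin ⟩
  2 ^ n                          ∎
  where open ≡-Reasoning

orthogonalCount : Vec Bool n → ℕ
orthogonalCount {n} v = sumCube n (λ d → 𝟙 (not (dot d v)))

orthogonalCount-half : (v : Vec Bool n) → 2 * orthogonalCount v ≡ 2 ^ n + 2 ^ n * 𝟙 (isZero v)
orthogonalCount-half [] = refl
orthogonalCount-half {suc n} (true ∷ v) = begin
  2 * (sumCube n (λ d → 𝟙 (not (dot d v))) + sumCube n (λ d → 𝟙 (not (true xor dot d v))))
    ≡⟨ cong (2 *_) (sym (sumCube-+ n _ _)) ⟩
  2 * sumCube n (λ d → 𝟙 (not (dot d v)) + 𝟙 (not (true xor dot d v)))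
    ≡⟨ cong (2 *_) (trans (sumCube-cong n (λ d → exactly-one (dot d v))) (sumCube-const n 1)) ⟩
  2 * (1 * 2 ^ n)
    ≡⟨ solve 1 (λ t → con 2 :* (con 1 :* t) := con 2 :* t :+ con 2 :* t :* con 0) refl (2 ^ n) ⟩
  2 ^ suc n + 2 ^ suc n * 0 ∎
  where
  open ≡-Reasoning
  exactly-one : (b : Bool) → 𝟙 (not b) + 𝟙 (not (true xor b)) ≡ 1
  exactly-one true = refl
  exactly-one false = refl
orthogonalCount-half {suc n} (false ∷ v) = begin
  2 * (O + O)                                   ≡⟨ *-distribˡ-+ 2 O O ⟩
  2 * O + 2 * O                                 ≡⟨ cong₂ _+_ (orthogonalCount-half v) (orthogonalCount-half v) ⟩
  (2 ^ n + 2 ^ n * z) + (2 ^ n + 2 ^ n * z)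
    ≡⟨ solve 2 (λ t z → (t :+ t :* z) :+ (t :+ t :* z) := con 2 :* t :+ con 2 :* t :* z) refl (2 ^ n) z ⟩
  2 ^ suc n + 2 ^ suc n * z                     ∎
  where
  open ≡-Reasoning
  O z : ℕ
  O = orthogonalCount v
  z = 𝟙 (isZero v)

dot-vsum-when : (c : Bool) (p : Vec Bool n) (F : Mat n) (s : Vec Bool n) →
                dot (vsum (if c then p ∷ F else F)) s ≡ (c ∧ dot p s) xor dot (vsum F) s
dot-vsum-when true p F s = dot-⊕ˡ p (vsum F) s
dot-vsum-when false p F s = refl

form-when : (t : Bool) (p : Vec Bool n) (Q : Mat n) (d e : Vec Bool n) →
  dot (mulVec (if t then p ∷ Q else Q) d) (mulVec (if t then p ∷ Q else Q) e)
    ≡ (t ∧ (dot p d ∧ dot p e)) xor dot (mulVec Q d) (mulVec Q e)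
form-when true p Q d e = refl
form-when false p Q d e = refl

-- Y(d,e) · sᵀ = (P_s d)ᵀ (P_s e): only the rows of P_s contribute.
Y-form : (P : Mat n) (d e s : Vec Bool n) →
         dot (Yval P d e) s ≡ dot (mulVec (sub P s) d) (mulVec (sub P s) e)
Y-form [] d e s = dot-zeroˡ s
Y-form (p ∷ P) d e s = begin
  dot (Yval (p ∷ P) d e) s
    ≡⟨ dot-vsum-when (dot p d ∧ dot p e) p (filterB (λ q → dot q d ∧ dot q e) P) s ⟩
  ((dot p d ∧ dot p e) ∧ dot p s) xor dot (Yval P d e) s
    ≡⟨ cong₂ _xor_ (∧-comm (dot p d ∧ dot p e) (dot p s)) (Y-form P d e s) ⟩
  (dot p s ∧ (dot p d ∧ dot p e)) xor dot (mulVec (sub P s) d) (mulVec (sub P s) e)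
    ≡⟨ sym (form-when (dot p s) p (sub P s) d e) ⟩
  dot (mulVec (sub (p ∷ P) s) d) (mulVec (sub (p ∷ P) s) e) ∎
  where open ≡-Reasoning

-- QᵀQ e = Σ_{p ∈ Q} (p · e) p.
gramApply : Mat n → Vec Bool n → Vec Bool n
gramApply Q e = vsum (map (λ p → dot p e · p) Q)

form-gram : (Q : Mat n) (d e : Vec Bool n) → dot (mulVec Q d) (mulVec Q e) ≡ dot d (gramApply Q e)
form-gram [] d e = sym (dot-zeroʳ d)
form-gram (p ∷ Q) d e = begin
  (dot p d ∧ dot p e) xor dot (mulVec Q d) (mulVec Q e)
    ≡⟨ cong₂ _xor_ (trans (∧-comm (dot p d) (dot p e)) (cong (dot p e ∧_) (dot-comm p d))) (form-gram Q d e) ⟩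
  (dot p e ∧ dot d p) xor dot d (gramApply Q e)
    ≡⟨ cong (_xor dot d (gramApply Q e)) (sym (·-pull (dot d) (dot-zeroʳ d) (dot p e) p)) ⟩
  dot d (dot p e · p) xor dot d (gramApply Q e)
    ≡⟨ sym (dot-⊕ʳ (dot p e · p) (gramApply Q e) d) ⟩
  dot d (gramApply (p ∷ Q) e) ∎
  where open ≡-Reasoning

gram-row : (Q : Mat n) (i : Fin n) (e : Vec Bool n) →
           dot (vsum (map (λ p → lookup p i · p) Q)) e ≡ lookup (gramApply Q e) i
gram-row {n} [] i e = trans (dot-zeroˡ e) (sym (lookup-replicate i false))
gram-row {n} (p ∷ Q) i e = begin
  dot ((lookup p i · p) ⊕ R) e
    ≡⟨ dot-⊕ˡ (lookup p i · p) R e ⟩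
  dot (lookup p i · p) e xor dot R e
    ≡⟨ cong₂ _xor_ (·-pull (λ v → dot v e) (dot-zeroˡ e) (lookup p i) p) (gram-row Q i e) ⟩
  (lookup p i ∧ dot p e) xor lookup (gramApply Q e) i
    ≡⟨ cong (_xor lookup (gramApply Q e) i)
            (trans (∧-comm (lookup p i) (dot p e))
                   (sym (·-pull (λ v → lookup v i) (lookup-replicate i false) (dot p e) p))) ⟩
  lookup (dot p e · p) i xor lookup (gramApply Q e) i
    ≡⟨ sym (lookup-zipWith _xor_ i (dot p e · p) (gramApply Q e)) ⟩
  lookup (gramApply (p ∷ Q) e) i ∎
  where
  open ≡-Reasoning
  R : Vec Bool n
  R = vsum (map (λ q → lookup q i · q) Q)

isZero-mulVec-rows : (V : Vec (Vec Bool n) k) (e : Vec Bool n) →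
                     isZero (mulVec (toList V) e) ≡ isZero (Data.Vec.map (λ r → dot r e) V)
isZero-mulVec-rows [] e = refl
isZero-mulVec-rows (r ∷ V) e = cong (not (dot r e) ∧_) (isZero-mulVec-rows V e)

gram-kernel : (Q : Mat n) (e : Vec Bool n) → isZero (mulVec (gram Q) e) ≡ isZero (gramApply Q e)
gram-kernel Q e = begin
  isZero (mulVec (gram Q) e)
    ≡⟨ isZero-mulVec-rows (tabulate row) e ⟩
  isZero (Data.Vec.map (λ r → dot r e) (tabulate row))
    ≡⟨ cong isZero (sym (tabulate-∘ (λ r → dot r e) row)) ⟩
  isZero (tabulate (λ i → dot (row i) e))
    ≡⟨ cong isZero (tabulate-cong (λ i → gram-row Q i e)) ⟩
  isZero (tabulate (lookup (gramApply Q e)))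
    ≡⟨ cong isZero (tabulate∘lookup (gramApply Q e)) ⟩
  isZero (gramApply Q e) ∎
  where
  open ≡-Reasoning
  row : Fin _ → Vec Bool _
  row i = vsum (map (λ p → lookup p i · p) Q)

countY-form : (P : Mat n) (s : Vec Bool n) →
  countY P s ≡ sumCube n (λ d → sumCube n (λ e →
                  𝟙 (not (dot (mulVec (sub P s) d) (mulVec (sub P s) e)))))
countY-form {n} P s =
  trans (count-allPairs n _)
        (sumCube-cong n (λ d → sumCube-cong n (λ e → cong (λ b → 𝟙 (not b)) (Y-form P d e s))))

countOrth-sum : (Q : Mat n) →
  countOrth Q ≡ sumCube (length Q) (λ c₁ → sumCube (length Q) (λ c₂ →
                  onImage (mulVec Q) (λ c → onImage (mulVec Q) (λ c′ → 𝟙 (not (dot c c′))) c₂) c₁))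
countOrth-sum Q =
  trans (count-allPairs (length Q) _)
        (sumCube-cong (length Q) (λ c₁ → sumCube-cong (length Q) (λ c₂ →
          𝟙-∧ (inCode Q c₁) (inCode Q c₂) (not (dot c₁ c₂)))))
  where
  𝟙-∧ : (a b x : Bool) → 𝟙 (a ∧ b ∧ x) ≡ (if a then (if b then 𝟙 x else 0) else 0)
  𝟙-∧ true true x = refl
  𝟙-∧ true false x = refl
  𝟙-∧ false b x = refl

-- (d,e) ↦ (P_s d, P_s e) is |ker P_s|²-to-one onto C_s²: #{Y · sᵀ = 0} = K² · O.
countY-code : (P : Mat n) (s : Vec Bool n) →
  countY P s ≡ kernelSize (mulVec (sub P s)) * (kernelSize (mulVec (sub P s)) * countOrth (sub P s))
countY-code {n} P s = begin
  countY P s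
    ≡⟨ countY-form P s ⟩
  sumCube n (λ d → sumCube n (λ e → orthogonal (mulVec Q d) (mulVec Q e)))
    ≡⟨ sumCube²-linear (mulVec Q) (mulVec-linear Q) orthogonal ⟩
  K * (K * sumCube rows (λ c₁ → sumCube rows (λ c₂ →
             onImage (mulVec Q) (λ c → onImage (mulVec Q) (orthogonal c) c₂) c₁)))
    ≡⟨ cong (λ t → K * (K * t)) (sym (countOrth-sum Q)) ⟩
  K * (K * countOrth Q) ∎
  where
  open ≡-Reasoning
  Q : Mat n
  Q = sub P s
  rows : ℕ
  rows = length Q
  K : ℕ
  K = kernelSize (mulVec Q)
  orthogonal : Vec Bool rows → Vec Bool rows → ℕ
  orthogonal c c′ = 𝟙 (not (dot c c′))

kernel-codeSize : (Q : Mat n) → kernelSize (mulVec Q) * codeSize Q ≡ 2 ^ n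
kernel-codeSize Q =
  trans (cong (kernelSize (mulVec Q) *_) (count-allVecs (length Q) (inCode Q)))
        (kernel-image (mulVec Q) (mulVec-linear Q))

-- Summing over d first: 2 · #{Y · sᵀ = 0} = 2ⁿ · 2ⁿ + 2ⁿ · |ker P_sᵀP_s|.
countY-gram : (P : Mat n) (s : Vec Bool n) →
  2 * countY P s ≡ 2 ^ n * 2 ^ n + 2 ^ n * kernelSize (mulVec (gram (sub P s)))
countY-gram {n} P s = begin
  2 * countY P s
    ≡⟨ cong (2 *_) (trans (countY-form P s)
         (trans (sumCube-cong n (λ d → sumCube-cong n (λ e → cong (λ b → 𝟙 (not b)) (form-gram Q d e))))
                (sumCube-swap n n _))) ⟩
  2 * sumCube n (λ e → orthogonalCount (gramApply Q e))
    ≡⟨ sym (sumCube-*ˡ n 2 _) ⟩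
  sumCube n (λ e → 2 * orthogonalCount (gramApply Q e))
    ≡⟨ sumCube-cong n (λ e → orthogonalCount-half (gramApply Q e)) ⟩
  sumCube n (λ e → N + N * 𝟙 (isZero (gramApply Q e)))
    ≡⟨ sumCube-+ n (λ _ → N) _ ⟩
  sumCube n (λ _ → N) + sumCube n (λ e → N * 𝟙 (isZero (gramApply Q e)))
    ≡⟨ cong₂ _+_ (sumCube-const n N) (sumCube-*ˡ n N _) ⟩
  N * N + N * sumCube n (λ e → 𝟙 (isZero (gramApply Q e)))
    ≡⟨ cong (λ t → N * N + N * t) (sumCube-cong n (λ e → cong 𝟙 (sym (gram-kernel Q e)))) ⟩
  N * N + N * kernelSize (mulVec (gram Q)) ∎
  where
  open ≡-Reasoning
  Q : Mat n
  Q = sub P s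
  N : ℕ
  N = 2 ^ n

bias-arithmetic : (Y O C K K-G R N : ℕ) → .{{NonZero N}} →
  Y ≡ K * (K * O) → K * C ≡ N → 2 * Y ≡ N * N + N * K-G → R * K-G ≡ N →
  (Y * (C * C) ≡ O * (N * N)) × (O * (2 * R) ≡ (C * C) * (R + 1))
bias-arithmetic Y O C K K-G R N Y≡K²O KC≡N 2Y≡ RK-G≡N = Y-identity , O-identity
  where
  open ≡-Reasoning
  Y-identity : Y * (C * C) ≡ O * (N * N)
  Y-identity = begin
    Y * (C * C)               ≡⟨ cong (_* (C * C)) Y≡K²O ⟩
    K * (K * O) * (C * C)     ≡⟨ solve 3 (λ k c o → k :* (k :* o) :* (c :* c) := o :* ((k :* c) :* (k :* c))) refl K C O ⟩
    O * ((K * C) * (K * C))   ≡⟨ cong (λ t → O * (t * t)) KC≡N ⟩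
    O * (N * N)               ∎
  instance
    K≢0 : NonZero K
    K≢0 = factor-nonZero K C N KC≡N
  O-identity : O * (2 * R) ≡ (C * C) * (R + 1)
  O-identity = *-cancelˡ-≡ _ _ (K * K) {{m*n≢0 K K}} (begin
    K * K * (O * (2 * R))         ≡⟨ solve 3 (λ k o r → k :* k :* (o :* (con 2 :* r)) := con 2 :* (k :* (k :* o)) :* r) refl K O R ⟩
    2 * (K * (K * O)) * R         ≡⟨ cong (λ t → 2 * t * R) (sym Y≡K²O) ⟩
    2 * Y * R                     ≡⟨ cong (_* R) 2Y≡ ⟩
    (N * N + N * K-G) * R         ≡⟨ solve 3 (λ n r g → (n :* n :+ n :* g) :* r := n :* n :* r :+ n :* (r :* g)) refl N R K-G ⟩
    N * N * R + N * (R * K-G)     ≡⟨ cong (λ t → N * N * R + N * t) RK-G≡N ⟩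
    N * N * R + N * N             ≡⟨ cong (λ t → t * t * R + t * t) (sym KC≡N) ⟩
    (K * C) * (K * C) * R + (K * C) * (K * C)
      ≡⟨ solve 3 (λ k c r → (k :* c) :* (k :* c) :* r :+ (k :* c) :* (k :* c) := k :* k :* ((c :* c) :* (r :+ con 1))) refl K C R ⟩
    K * K * ((C * C) * (R + 1))   ∎)

4^n≡2^n*2^n : (n : ℕ) → 4 ^ n ≡ 2 ^ n * 2 ^ n
4^n≡2^n*2^n zero = refl
4^n≡2^n*2^n (suc n) = trans (cong (4 *_) (4^n≡2^n*2^n n))
  (solve 1 (λ t → con 4 :* (t :* t) := (con 2 :* t) :* (con 2 :* t)) refl (2 ^ n))

mainTheorem15 : (n : ℕ) (P : Mat n) (s : Vec Bool n) →
    (countY P s * (codeSize (sub P s) * codeSize (sub P s))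
       ≡ countOrth (sub P s) * 4 ^ n)
    × (countOrth (sub P s) * 2 ^ suc (rank (gram (sub P s)))
       ≡ (codeSize (sub P s) * codeSize (sub P s)) * (2 ^ rank (gram (sub P s)) + 1))
mainTheorem15 n P s =
  let Y-identity , O-identity =
        bias-arithmetic (countY P s) (countOrth Q) (codeSize Q) (kernelSize (mulVec Q))
                        (kernelSize G) (2 ^ rankOf G) (2 ^ n) {{m^n≢0 2 n}}
                        (countY-code P s) (kernel-codeSize Q) (countY-gram P s)
                        (rank-kernel G (mulVec-linear (gram Q)))
  in trans Y-identity (cong (countOrth Q *_) (sym (4^n≡2^n*2^n n))) , O-identity
  where
  Q : Mat n
  Q = sub P s
  G : Vec Bool n → Vec Bool (length (gram Q))
  G = mulVec (gram Q)
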